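{- Let $y,k\in\mathbb{N}$ and let $p$ be a prime with $|W(y)|\le|W(Y_{p,k})|$. If there is a prime $s\le p$ with $s\notin W(y)$, then $D(W(y),W(Y_{p,k}))\ge1$.
   Context: $W(x)$ is the set of prime divisors of $x$. For a prime $p$, $p_i$ is the $i$th smallest prime greater than $p$, and $Y_{p,k}=\prod_{q\text{ prime},\ q\le p_k,\ q\ne p}q$. For finite sets of primes $A,B$, $D(A,B)=\left(\prod_{q\in A}\frac{q-1}{q}\right)\left(\prod_{q\in B}\frac{q}{q-1}\right)$. -}

module Defs where

open import Data.Nat using (ℕ; zero; suc; _∸_)
open import Data.Nat.Primality using (Prime; prime?)
open import Data.Nat.Divisibility using (_∣?_)
open import Data.Nat.Properties using (_≟_)
open import Data.Integer using (+_)
open import Data.Rational using (ℚ; _/_; 0ℚ; 1ℚ; _*_)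
open import Data.List using (List; filter; upTo; foldr; map)
open import Data.Nat.ListAction using (product)
open import Relation.Nullary.Decidable using (_×-dec_; ¬?)

-- W x : the prime divisors of x, as a list in increasing order
-- (intended for x ≥ 1; every prime divisor of x ≥ 1 is ≤ x).
W : ℕ → List ℕ
W x = filter (λ q → prime? q ×-dec (q ∣? x)) (upTo (suc x))

primesUpTo : ℕ → List ℕ
primesUpTo n = filter (λ q → prime? q) (upTo (suc n))

-- IsPrimeAfter p i q : q is p_i, the i-th smallest prime greater than p
-- (q prime and exactly i primes lie in (p, q]; for i = 0 this forces q = p
-- when p is prime).
IsPrimeAfter : ℕ → ℕ → ℕ → Set
IsPrimeAfter p i q =
  Prime q × (Data.List.length (primesUpTo q) ≡ i + Data.List.length (primesUpTo p))
  where
    open import Data.Product using (_×_)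
    open import Relation.Binary.PropositionalEquality using (_≡_)
    open import Data.Nat using (_+_)

-- Y p pk = product of primes q ≤ pk with q ≠ p  (pk plays the role of p_k)
Y : ℕ → ℕ → ℕ
Y p pk = product (filter (λ q → ¬? (q ≟ p)) (primesUpTo pk))

-- a / b as a rational, for b ≥ 1 (b = 0 never occurs in uses below, since
-- all arguments come from primes).
ratio : ℕ → ℕ → ℚ
ratio a zero = 0ℚ
ratio a (suc b) = (+ a) / suc b

prodℚ : List ℚ → ℚ
prodℚ = foldr _*_ 1ℚ

D : List ℕ → List ℕ → ℚ
D A B = prodℚ (map (λ q → ratio (q ∸ 1) q) A) * prodℚ (map (λ q → ratio q (q ∸ 1)) B)

{-# OPTIONS --safe #-}
-- With ρ q = (q - 1)/q, D(A, B) = ∏_A ρ / ∏_B ρ, so it suffices that ∏_B ρ ≤ ∏_A ρ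
-- for A = W(y), B = W(Y_{p,k}).  As ρ is increasing with values in [0, 1], this
-- follows from an injection A → B sending each a to some b ≤ a.  Primes of A ∩ B go
-- to themselves.  Every other prime of A exceeds p_k, hence every prime of B, except
-- possibly p itself, which is sent to s.  The hypothesis |A| ≤ |B| leaves enough
-- free primes in B.
module Submission where

open import Defs
open import Data.Nat using (ℕ; _≤_; NonZero)
open import Data.Nat.Primality using (Prime)
open import Data.List using (length)
open import Data.List.Membership.Propositional using (_∈_)
open import Data.Product using (Σ; _×_)
open import Relation.Nullary using (¬_)
open import Data.Rational using (1ℚ)
open import Data.Rational using () renaming (_≤_ to _≤ℚ_)

open import Data.Nat as ℕ using (zero; suc; _<_; _∸_; z≤n; s≤s; s≤s⁻¹)
import Data.Nat.Properties as ℕ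
open import Data.Nat.Divisibility using (_∣_; _∣?_; ∣⇒≤)
open import Data.Nat.Primality using (prime?; prime⇒nonTrivial; productOfPrimes≢0)
open import Data.Nat.Primality.Factorisation using (factorisationHasAllPrimeFactors)
open import Data.Nat.ListAction.Properties using (∈⇒∣product)
open import Data.Integer as ℤ using (+_)
import Data.Integer.Properties as ℤ
open import Data.Rational using (ℚ; 0ℚ; _*_; toℚᵘ; NonNegative; nonNegative)
open import Data.Rational.Properties
import Data.Rational.Unnormalised as ℚᵘ
import Data.Rational.Unnormalised.Properties as ℚᵘ
open import Algebra.Bundles using (CommutativeMonoid)
open import Algebra.Properties.CommutativeSemigroup
  (CommutativeMonoid.commutativeSemigroup *-1-commutativeMonoid) using (x∙yz≈y∙xz; interchange)
open import Data.List using (List; []; _∷_; map; filter; upTo)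
open import Data.List.Membership.Propositional using (_∉_; find)
open import Data.List.Membership.Propositional.Properties using (∈-filter⁺; ∈-filter⁻; ∈-upTo⁺; ∈-upTo⁻)
open import Data.List.Membership.DecPropositional ℕ._≟_ using (_∈?_)
open import Data.List.Relation.Binary.Subset.Propositional using (_⊆_)
open import Data.List.Relation.Unary.Any using (here; there; _─_)
open import Data.List.Relation.Unary.All as All using (All; []; _∷_; all?)
open import Data.List.Relation.Unary.All.Properties using (─⁺; All¬⇒¬Any; ¬All⇒Any¬)
open import Data.List.Relation.Unary.AllPairs using ([]; _∷_)
open import Data.List.Relation.Unary.Unique.Propositional using (Unique)
import Data.List.Relation.Unary.Unique.Propositional.Properties as Unique
open import Data.Product using (∃-syntax; _,_; proj₁; proj₂)
open import Data.Sum using (_⊎_; inj₁; inj₂; [_,_]′)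
open import Function using (_∘_)
open import Relation.Binary.PropositionalEquality
open import Relation.Nullary using (yes; no; ¬?; contradiction)
open import Relation.Nullary.Decidable using (_×-dec_)

module _ {a} {A : Set a} where

  length-─ : ∀ {x : A} {xs} (x∈xs : x ∈ xs) → length xs ≡ suc (length (xs ─ x∈xs))
  length-─ (here _)     = refl
  length-─ (there x∈xs) = cong suc (length-─ x∈xs)

  ∈-─⁻ : ∀ {x z : A} {xs} (x∈xs : x ∈ xs) → z ∈ (xs ─ x∈xs) → z ∈ xs
  ∈-─⁻ (here _)     z∈         = there z∈
  ∈-─⁻ (there _)    (here z≡y) = here z≡y
  ∈-─⁻ (there x∈xs) (there z∈) = there (∈-─⁻ x∈xs z∈)

  ∈-─⁺ : ∀ {x z : A} {xs} (x∈xs : x ∈ xs) → z ∈ xs → z ≢ x → z ∈ (xs ─ x∈xs)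
  ∈-─⁺ (here refl)  (here z≡x) z≢x = contradiction z≡x z≢x
  ∈-─⁺ (here refl)  (there z∈) _   = z∈
  ∈-─⁺ (there _)    (here z≡y) _   = here z≡y
  ∈-─⁺ (there x∈xs) (there z∈) z≢x = there (∈-─⁺ x∈xs z∈ z≢x)

  ∈-─⇒≢ : ∀ {x z : A} {xs} → Unique xs → (x∈xs : x ∈ xs) → z ∈ (xs ─ x∈xs) → z ≢ x
  ∈-─⇒≢ (x≢ ∷ _) (here refl)  z∈         z≡x = All.lookup x≢ z∈ (sym z≡x)
  ∈-─⇒≢ (y≢ ∷ _) (there x∈xs) (here refl) = All.lookup y≢ x∈xs
  ∈-─⇒≢ (_ ∷ u)  (there x∈xs) (there z∈) = ∈-─⇒≢ u x∈xs z∈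

  Unique-─ : ∀ {x : A} {xs} → Unique xs → (x∈xs : x ∈ xs) → Unique (xs ─ x∈xs)
  Unique-─ (_ ∷ u)  (here _)     = u
  Unique-─ (y≢ ∷ u) (there x∈xs) = ─⁺ x∈xs y≢ ∷ Unique-─ u x∈xs

  Unique-⊆⇒length-≤ : ∀ {xs ys : List A} → Unique xs → xs ⊆ ys → length xs ≤ length ys
  Unique-⊆⇒length-≤ {[]}     _          _   = z≤n
  Unique-⊆⇒length-≤ {x ∷ xs} {ys} (x≢ ∷ uxs) xs⊆ys = begin
    suc (length xs)          ≤⟨ s≤s (Unique-⊆⇒length-≤ uxs xs⊆ys─x) ⟩
    suc (length (ys ─ x∈ys)) ≡⟨ length-─ x∈ys ⟨
    length ys                ∎
    where
    open ℕ.≤-Reasoning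
    x∈ys : x ∈ ys
    x∈ys = xs⊆ys (here refl)
    xs⊆ys─x : xs ⊆ (ys ─ x∈ys)
    xs⊆ys─x z∈xs = ∈-─⁺ x∈ys (xs⊆ys (there z∈xs)) (All.lookup x≢ z∈xs ∘ sym)

∃-fresh-≤ : ∀ {t a} {A B : List ℕ} → a ∉ A → Unique B → length A < length B →
  (a ∉ B → t ≤ a) → (∀ {b} → b ∈ B → b ≤ t) → ∃[ b ] b ∈ B × b ≤ a × b ∉ A
∃-fresh-≤ {a = a} {A} {B} a∉A uB |A|<|B| a∉B⇒t≤a B≤t with a ∈? B
... | yes a∈B = a , a∈B , ℕ.≤-refl , a∉A
... | no  a∉B with all? (_∈? A) B
...   | yes B⊆A = contradiction (Unique-⊆⇒length-≤ uB (All.lookup B⊆A)) (ℕ.<⇒≱ |A|<|B|)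
...   | no  B⊈A with find (¬All⇒Any¬ (_∈? A) B B⊈A)
...     | b , b∈B , b∉A = b , b∈B , ℕ.≤-trans (B≤t b∈B) (a∉B⇒t≤a a∉B) , b∉A

∏ : (ℕ → ℚ) → List ℕ → ℚ
∏ f xs = prodℚ (map f xs)

*-mono-≤-nonNeg : ∀ {p q r s} → 0ℚ ≤ℚ q → 0ℚ ≤ℚ r → p ≤ℚ q → r ≤ℚ s → p * r ≤ℚ q * s
*-mono-≤-nonNeg {q = q} {r} 0≤q 0≤r p≤q r≤s = ≤-trans
  (*-monoʳ-≤-nonNeg r {{nonNegative 0≤r}} p≤q)
  (*-monoˡ-≤-nonNeg q {{nonNegative 0≤q}} r≤s)

module _ (f : ℕ → ℚ) where

  ∏-nonNeg : (∀ n → 0ℚ ≤ℚ f n) → ∀ xs → 0ℚ ≤ℚ ∏ f xs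
  ∏-nonNeg f≥0 []       = nonNegative⁻¹ 1ℚ
  ∏-nonNeg f≥0 (x ∷ xs) = nonNegative⁻¹ _
    {{nonNeg*nonNeg⇒nonNeg (f x) {{nonNegative (f≥0 x)}} (∏ f xs) {{nonNegative (∏-nonNeg f≥0 xs)}}}}

  ∏-≤1 : (∀ n → 0ℚ ≤ℚ f n) → (∀ n → f n ≤ℚ 1ℚ) → ∀ xs → ∏ f xs ≤ℚ 1ℚ
  ∏-≤1 f≥0 f≤1 []       = ≤-refl
  ∏-≤1 f≥0 f≤1 (x ∷ xs) = subst (f x * ∏ f xs ≤ℚ_) (*-identityˡ 1ℚ)
    (*-mono-≤-nonNeg (nonNegative⁻¹ 1ℚ) (∏-nonNeg f≥0 xs) (f≤1 x) (∏-≤1 f≥0 f≤1 xs))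

  ∏-─ : ∀ {x xs} (x∈xs : x ∈ xs) → ∏ f xs ≡ f x * ∏ f (xs ─ x∈xs)
  ∏-─ (here refl) = refl
  ∏-─ {x} (there {x = y} {xs} x∈xs) = begin
    f y * ∏ f xs                    ≡⟨ cong (f y *_) (∏-─ x∈xs) ⟩
    f y * (f x * ∏ f (xs ─ x∈xs))   ≡⟨ x∙yz≈y∙xz (f y) (f x) _ ⟩
    f x * (f y * ∏ f (xs ─ x∈xs))   ∎
    where open ≡-Reasoning

  ∏-inverse : ∀ {g : ℕ → ℚ} {xs} → All (λ x → f x * g x ≡ 1ℚ) xs → ∏ f xs * ∏ g xs ≡ 1ℚ
  ∏-inverse {g} {[]}     []           = refl
  ∏-inverse {g} {x ∷ xs} (fg≡1 ∷ fgs) = begin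
    (f x * ∏ f xs) * (g x * ∏ g xs)   ≡⟨ interchange (f x) (∏ f xs) (g x) (∏ g xs) ⟩
    (f x * g x) * (∏ f xs * ∏ g xs)   ≡⟨ cong₂ _*_ fg≡1 (∏-inverse fgs) ⟩
    1ℚ * 1ℚ                           ≡⟨ *-identityˡ 1ℚ ⟩
    1ℚ                                ∎
    where open ≡-Reasoning

  module _ (f≥0 : ∀ n → 0ℚ ≤ℚ f n) (f-mono : ∀ {m n} → m ≤ n → f m ≤ℚ f n) where

    ∏-exchange : ∀ {a b A B} (a∈A : a ∈ A) (b∈B : b ∈ B) → b ≤ a →
      ∏ f (B ─ b∈B) ≤ℚ ∏ f (A ─ a∈A) → ∏ f B ≤ℚ ∏ f A
    ∏-exchange {a} {b} {A} {B} a∈A b∈B b≤a rest = begin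
      ∏ f B                 ≡⟨ ∏-─ b∈B ⟩
      f b * ∏ f (B ─ b∈B)   ≤⟨ *-mono-≤-nonNeg (f≥0 a) (∏-nonNeg f≥0 (B ─ b∈B)) (f-mono b≤a) rest ⟩
      f a * ∏ f (A ─ a∈A)   ≡⟨ ∏-─ a∈A ⟨
      ∏ f A                 ∎
      where open ≤-Reasoning

    ∏-≤-separated : (∀ n → f n ≤ℚ 1ℚ) → ∀ t {A B} → Unique A → Unique B → length A ≤ length B →
      (∀ {a} → a ∈ A → a ∉ B → t ≤ a) → (∀ {b} → b ∈ B → b ≤ t) → ∏ f B ≤ℚ ∏ f A
    ∏-≤-separated f≤1 t {[]}    {B} _          _  _       _       _       = ∏-≤1 f≥0 f≤1 B
    ∏-≤-separated f≤1 t {a ∷ A} {B} (a≢ ∷ uA) uB |A|<|B| A-large B-small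
      with ∃-fresh-≤ (All¬⇒¬Any a≢) uB |A|<|B| (A-large (here refl)) B-small
    ... | b , b∈B , b≤a , b∉A = ∏-exchange {A = a ∷ A} (here refl) b∈B b≤a
      (∏-≤-separated f≤1 t uA (Unique-─ uB b∈B) |A|≤|B─b| A-large′ (B-small ∘ ∈-─⁻ b∈B))
      where
      |A|≤|B─b| : length A ≤ length (B ─ b∈B)
      |A|≤|B─b| = s≤s⁻¹ (ℕ.≤-trans |A|<|B| (ℕ.≤-reflexive (length-─ b∈B)))
      A-large′ : ∀ {a′} → a′ ∈ A → a′ ∉ (B ─ b∈B) → t ≤ a′
      A-large′ a′∈A a′∉B─b = A-large (there a′∈A) λ a′∈B →
        a′∉B─b (∈-─⁺ b∈B a′∈B λ a′≡b → b∉A (subst (_∈ A) a′≡b a′∈A))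

toℚᵘ-ratio : ∀ a b → toℚᵘ (ratio a (suc b)) ℚᵘ.≃ ℚᵘ.mkℚᵘ (+ a) b
toℚᵘ-ratio a b = toℚᵘ-fromℚᵘ (ℚᵘ.mkℚᵘ (+ a) b)

ratio-≤ : ∀ a b c d → a ℕ.* suc d ≤ c ℕ.* suc b → ratio a (suc b) ≤ℚ ratio c (suc d)
ratio-≤ a b c d ad≤cb = toℚᵘ-cancel-≤ (begin
  toℚᵘ (ratio a (suc b))   ≃⟨ toℚᵘ-ratio a b ⟩
  ℚᵘ.mkℚᵘ (+ a) b          ≤⟨ ℚᵘ.*≤* (subst₂ ℤ._≤_ (ℤ.pos-* a (suc d)) (ℤ.pos-* c (suc b)) (ℤ.+≤+ ad≤cb)) ⟩
  ℚᵘ.mkℚᵘ (+ c) d          ≃⟨ toℚᵘ-ratio c d ⟨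
  toℚᵘ (ratio c (suc d))   ∎)
  where open ℚᵘ.≤-Reasoning

ρ : ℕ → ℚ
ρ q = ratio (q ∸ 1) q

ρ⁻¹ : ℕ → ℚ
ρ⁻¹ q = ratio q (q ∸ 1)

ρ-nonNeg : ∀ q → 0ℚ ≤ℚ ρ q
ρ-nonNeg zero    = ≤-refl
ρ-nonNeg (suc n) = ratio-≤ 0 0 n n z≤n

ρ-≤1 : ∀ q → ρ q ≤ℚ 1ℚ
ρ-≤1 zero    = nonNegative⁻¹ 1ℚ
ρ-≤1 (suc n) = ratio-≤ n n 1 0 (begin
  n ℕ.* 1       ≡⟨ ℕ.*-identityʳ n ⟩
  n             ≤⟨ ℕ.n≤1+n n ⟩
  suc n         ≡⟨ ℕ.*-identityˡ (suc n) ⟨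
  1 ℕ.* suc n   ∎)
  where open ℕ.≤-Reasoning

ρ-mono : ∀ {m n} → m ≤ n → ρ m ≤ℚ ρ n
ρ-mono {zero}  {n}     _         = ρ-nonNeg n
ρ-mono {suc m} {suc n} (s≤s m≤n) = ratio-≤ m m n n (begin
  m ℕ.* suc n   ≡⟨ ℕ.*-suc m n ⟩
  m ℕ.+ m ℕ.* n ≤⟨ ℕ.+-mono-≤ m≤n (ℕ.≤-reflexive (ℕ.*-comm m n)) ⟩
  n ℕ.+ n ℕ.* m ≡⟨ ℕ.*-suc n m ⟨
  n ℕ.* suc m   ∎)
  where open ℕ.≤-Reasoning

ρ⁻¹-nonNeg : ∀ q → 0ℚ ≤ℚ ρ⁻¹ q
ρ⁻¹-nonNeg zero          = ≤-refl
ρ⁻¹-nonNeg (suc zero)    = ≤-refl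
ρ⁻¹-nonNeg (suc (suc n)) = ratio-≤ 0 0 (suc (suc n)) n z≤n

ρ*ρ⁻¹≡1 : ∀ {q} → 2 ≤ q → ρ q * ρ⁻¹ q ≡ 1ℚ
ρ*ρ⁻¹≡1 {suc (suc n)} (s≤s (s≤s _)) = toℚᵘ-injective (begin-equality
  toℚᵘ (ρ q * ρ⁻¹ q)                              ≃⟨ toℚᵘ-homo-* (ρ q) (ρ⁻¹ q) ⟩
  toℚᵘ (ρ q) ℚᵘ.* toℚᵘ (ρ⁻¹ q)                    ≃⟨ ℚᵘ.*-cong (toℚᵘ-ratio (suc n) (suc n)) (toℚᵘ-ratio q n) ⟩
  ℚᵘ.mkℚᵘ (+ suc n) (suc n) ℚᵘ.* ℚᵘ.mkℚᵘ (+ q) n  ≃⟨ ℚᵘ.*≡* cross ⟩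
  ℚᵘ.1ℚᵘ                                          ∎)
  where
  open ℚᵘ.≤-Reasoning
  q : ℕ
  q = suc (suc n)
  cross : (+ suc n ℤ.* + q) ℤ.* + 1 ≡ + 1 ℤ.* (+ q ℤ.* + suc n)
  cross = trans (ℤ.*-identityʳ _) (trans (ℤ.*-comm (+ suc n) (+ q)) (sym (ℤ.*-identityˡ _)))

1≤D : ∀ A B → All (2 ≤_) B → ∏ ρ B ≤ℚ ∏ ρ A → 1ℚ ≤ℚ D A B
1≤D A B B≥2 ∏B≤∏A = begin
  1ℚ                ≡⟨ ∏-inverse ρ (All.map ρ*ρ⁻¹≡1 B≥2) ⟨
  ∏ ρ B * ∏ ρ⁻¹ B   ≤⟨ *-monoʳ-≤-nonNeg (∏ ρ⁻¹ B) {{∏ρ⁻¹≥0}} ∏B≤∏A ⟩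
  ∏ ρ A * ∏ ρ⁻¹ B   ∎
  where
  open ≤-Reasoning
  ∏ρ⁻¹≥0 : NonNegative (∏ ρ⁻¹ B)
  ∏ρ⁻¹≥0 = nonNegative (∏-nonNeg ρ⁻¹ ρ⁻¹-nonNeg B)

∈-W⁻ : ∀ {x q} → q ∈ W x → Prime q × q ∣ x
∈-W⁻ {x} q∈Wx = proj₂ (∈-filter⁻ (λ q → prime? q ×-dec (q ∣? x)) {xs = upTo (suc x)} q∈Wx)

∈-W⁺ : ∀ {x q} → .{{NonZero x}} → Prime q → q ∣ x → q ∈ W x
∈-W⁺ {x} q-prime q∣x =
  ∈-filter⁺ (λ q → prime? q ×-dec (q ∣? x)) (∈-upTo⁺ (s≤s (∣⇒≤ q∣x))) (q-prime , q∣x)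

W-≥2 : ∀ x → All (2 ≤_) (W x)
W-≥2 x = All.tabulate λ q∈Wx → ℕ.nonTrivial⇒n>1 _ {{prime⇒nonTrivial (proj₁ (∈-W⁻ {x} q∈Wx))}}

Unique-W : ∀ x → Unique (W x)
Unique-W x = Unique.filter⁺ (λ q → prime? q ×-dec (q ∣? x)) (Unique.upTo⁺ (suc x))

∈-primesUpTo⁻ : ∀ {n q} → q ∈ primesUpTo n → Prime q × q ≤ n
∈-primesUpTo⁻ {n} q∈ with ∈-filter⁻ prime? {xs = upTo (suc n)} q∈
... | q∈upTo , q-prime = q-prime , s≤s⁻¹ (∈-upTo⁻ q∈upTo)

∈-primesUpTo⁺ : ∀ {n q} → Prime q → q ≤ n → q ∈ primesUpTo n
∈-primesUpTo⁺ q-prime q≤n = ∈-filter⁺ prime? (∈-upTo⁺ (s≤s q≤n)) q-prime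

module _ {p pk : ℕ} where

  private
    factors : List ℕ
    factors = filter (λ q → ¬? (q ℕ.≟ p)) (primesUpTo pk)

    ∈-factors⁻ : ∀ {q} → q ∈ factors → Prime q × q ≤ pk × q ≢ p
    ∈-factors⁻ q∈ with ∈-filter⁻ (λ q → ¬? (q ℕ.≟ p)) {xs = primesUpTo pk} q∈
    ... | q∈primes , q≢p = let q-prime , q≤pk = ∈-primesUpTo⁻ q∈primes in q-prime , q≤pk , q≢p

    factors-prime : All Prime factors
    factors-prime = All.tabulate (proj₁ ∘ ∈-factors⁻)

  ∈-W-Y⁻ : ∀ {q} → q ∈ W (Y p pk) → Prime q × q ≤ pk × q ≢ p
  ∈-W-Y⁻ q∈ = let q-prime , q∣Y = ∈-W⁻ q∈ in
    ∈-factors⁻ (factorisationHasAllPrimeFactors q-prime q∣Y factors-prime)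

  ∈-W-Y⁺ : ∀ {q} → Prime q → q ≤ pk → q ≢ p → q ∈ W (Y p pk)
  ∈-W-Y⁺ q-prime q≤pk q≢p = ∈-W⁺ {{productOfPrimes≢0 factors-prime}} q-prime
    (∈⇒∣product (∈-filter⁺ (λ q → ¬? (q ℕ.≟ p)) (∈-primesUpTo⁺ q-prime q≤pk) q≢p))

  ∉-W-Y⇒≡∨> : ∀ {q} → Prime q → q ∉ W (Y p pk) → q ≡ p ⊎ pk < q
  ∉-W-Y⇒≡∨> {q} q-prime q∉ with q ℕ.≟ p | q ℕ.≤? pk
  ... | yes q≡p | _       = inj₁ q≡p
  ... | no  q≢p | yes q≤pk = contradiction (∈-W-Y⁺ q-prime q≤pk q≢p) q∉
  ... | no  _   | no  q≰pk = inj₂ (ℕ.≰⇒> q≰pk)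

module _ {y p pk : ℕ} where

  private
    B-small : ∀ {b} → b ∈ W (Y p pk) → b ≤ pk
    B-small = proj₁ ∘ proj₂ ∘ ∈-W-Y⁻ {p} {pk}

    A-large : (p ∈ W y → pk < p) → ∀ {a} → a ∈ W y → a ∉ W (Y p pk) → pk ≤ a
    A-large p∈A⇒pk<p a∈A a∉B with ∉-W-Y⇒≡∨> {p} {pk} (proj₁ (∈-W⁻ {y} a∈A)) a∉B
    ... | inj₁ refl = ℕ.<⇒≤ (p∈A⇒pk<p a∈A)
    ... | inj₂ pk<a = ℕ.<⇒≤ pk<a

    ∏ρ-≤-separated : ∀ {A B} → Unique A → Unique B → length A ≤ length B →
      (∀ {a} → a ∈ A → a ∉ B → pk ≤ a) → (∀ {b} → b ∈ B → b ≤ pk) → ∏ ρ B ≤ℚ ∏ ρ A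
    ∏ρ-≤-separated = ∏-≤-separated ρ ρ-nonNeg ρ-mono ρ-≤1 pk

  ∏ρ-W-Y≤∏ρ-W : ∀ {s} → Prime s → s ≤ p → s ∉ W y →
    length (W y) ≤ length (W (Y p pk)) → ∏ ρ (W (Y p pk)) ≤ℚ ∏ ρ (W y)
  ∏ρ-W-Y≤∏ρ-W {s} s-prime s≤p s∉A |A|≤|B| with p ∈? W y | p ℕ.≤? pk
  ... | yes p∈A | yes p≤pk = ∏-exchange ρ ρ-nonNeg ρ-mono p∈A s∈B s≤p
    (∏ρ-≤-separated (Unique-─ (Unique-W y) p∈A) (Unique-─ (Unique-W (Y p pk)) s∈B) |A─p|≤|B─s|
      A─p-large (B-small ∘ ∈-─⁻ s∈B))
    where
    s∈B : s ∈ W (Y p pk)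
    s∈B = ∈-W-Y⁺ {p} {pk} s-prime (ℕ.≤-trans s≤p p≤pk) λ s≡p → s∉A (subst (_∈ W y) (sym s≡p) p∈A)
    |A─p|≤|B─s| : length (W y ─ p∈A) ≤ length (W (Y p pk) ─ s∈B)
    |A─p|≤|B─s| = s≤s⁻¹ (subst₂ _≤_ (length-─ p∈A) (length-─ s∈B) |A|≤|B|)
    A─p-large : ∀ {a} → a ∈ (W y ─ p∈A) → a ∉ (W (Y p pk) ─ s∈B) → pk ≤ a
    A─p-large {a} a∈A─p a∉B─s = [ (λ a≡p → contradiction a≡p (∈-─⇒≢ (Unique-W y) p∈A a∈A─p))
                                , ℕ.<⇒≤ ]′ (∉-W-Y⇒≡∨> {p} {pk} (proj₁ (∈-W⁻ {y} a∈A)) a∉B)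
      where
      a∈A : a ∈ W y
      a∈A = ∈-─⁻ p∈A a∈A─p
      a∉B : a ∉ W (Y p pk)
      a∉B a∈B = a∉B─s (∈-─⁺ s∈B a∈B λ a≡s → s∉A (subst (_∈ W y) a≡s a∈A))
  ... | yes _   | no p≰pk = ∏ρ-≤-separated (Unique-W y) (Unique-W (Y p pk)) |A|≤|B|
    (A-large λ _ → ℕ.≰⇒> p≰pk) B-small
  ... | no p∉A  | _       = ∏ρ-≤-separated (Unique-W y) (Unique-W (Y p pk)) |A|≤|B|
    (A-large λ p∈A → contradiction p∈A p∉A) B-small

lemma10 : (y k p pk : ℕ) → .{{NonZero y}} → Prime p → IsPrimeAfter p k pk →
    length (W y) ≤ length (W (Y p pk)) →
    Σ ℕ (λ s → Prime s × s ≤ p × ¬ (s ∈ W y)) →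
    1ℚ ≤ℚ D (W y) (W (Y p pk))
lemma10 y k p pk _ _ |Wy|≤|WY| (s , s-prime , s≤p , s∉Wy) =
  1≤D (W y) (W (Y p pk)) (W-≥2 (Y p pk)) (∏ρ-W-Y≤∏ρ-W {y} {p} {pk} s-prime s≤p s∉Wy |Wy|≤|WY|)
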